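{- Let $(X,\vartriangleleft,R,Q)$ be a modal frame. Define on subsets $A\subseteq X$: $\Box_RA=\{x\in X\mid R(x)\subseteq A\}$ and $\Diamond_QA=\{x\in X\mid \forall x'\vartriangleleft x\ \exists y'\in Q(x')\ \exists y\vartriangleright y'\colon y\in A\}$. Then $\Box_R$ and $\Diamond_Q$ send $c_\vartriangleleft$-fixpoints to $c_\vartriangleleft$-fixpoints; as operations on the lattice $\mathfrak{L}(X,\vartriangleleft)$ of $c_\vartriangleleft$-fixpoints, $\Box_R$ is completely multiplicative and $\Diamond_Q$ is monotone.
   Context: A modal frame is a tuple $(X,\vartriangleleft,R,Q)$ with $X$ a nonempty set and $\vartriangleleft,R,Q$ binary relations on $X$ such that for all $x,y,z\in X$: if $xRy$ and $z\vartriangleleft y$, then there is $x'\vartriangleleft x$ such that for all $x''$ with $x'\vartriangleleft x''$ there is $y''$ with $x''Ry''$ and $z\vartriangleleft y''$. Here $y\vartriangleright z$ means $z\vartriangleleft y$, and $S(x)=\{y\mid xSy\}$. The closure operator $c_\vartriangleleft$ on $\wp(X)$ is $c_\vartriangleleft(A)=\{x\in X\mid \forall y\vartriangleleft x\ \exists z\vartriangleright y: z\in A\}$; its fixpoints form a complete lattice $\mathfrak{L}(X,\vartriangleleft)$ with meet given by intersection and join given by $c_\vartriangleleft$ of the union. A unary operation $f$ on a lattice is completely multiplicative if $f(\bigwedge S)=\bigwedge\{f(a)\mid a\in S\}$ for every subset $S$ whose meet exists. -}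

module Defs where

open import Level using (0ℓ)
open import Data.Product using (Σ; _×_; ∃-syntax)
open import Relation.Unary using (Pred; _⊆_; _≐_; ⋂)

Subset : Set → Set₁
Subset X = Pred X 0ℓ

Rel : Set → Set₁
Rel X = X → X → Set

record ModalFrame : Set₁ where
  field
    X   : Set
    _◁_ : Rel X
    R   : Rel X
    Q   : Rel X
    frame-cond : ∀ {x y z} → R x y → z ◁ y →
      ∃[ x' ] (x' ◁ x × (∀ x'' → x' ◁ x'' → ∃[ y'' ] (R x'' y'' × z ◁ y'')))

module _ (F : ModalFrame) where
  open ModalFrame F

  c◁ : Subset X → Subset X
  c◁ A x = ∀ y → y ◁ x → ∃[ z ] (y ◁ z × A z)

  IsFixpoint : Subset X → Set
  IsFixpoint A = c◁ A ≐ A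

  □R : Subset X → Subset X
  □R A x = ∀ y → R x y → A y

  ◇Q : Subset X → Subset X
  ◇Q A x = ∀ x' → x' ◁ x → ∃[ y' ] (Q x' y' × ∃[ y ] (y' ◁ y × A y))

  -- Meet in 𝔏(X,◁) of a family of fixpoints indexed by I is their intersection.
  meet : (I : Set) → (I → Subset X) → Subset X
  meet I A = ⋂ I A

{-# OPTIONS --safe #-}
module Submission where

open import Defs
open import Data.Product using (_×_; _,_; ∃)
open import Function using (_∘_)
open import Relation.Unary using (_⊆_; _≐_)

-- Since c◁ is extensive, a fixpoint is just a set closed under c◁. Sets of
-- the form "every ◁-predecessor satisfies P" are always closed, and ◇Q A
-- has this form; □R preserves closedness by the frame condition, which
-- transports a witness for x' ◁ x to a witness below each R-successor of x.
-- Complete multiplicativity of □R and monotonicity of ◇Q hold for arbitrary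
-- subsets.

module _ (F : ModalFrame) where
  open ModalFrame F

  Closed : Subset X → Set
  Closed A = c◁ F A ⊆ A

  ⊆-c◁ : (A : Subset X) → A ⊆ c◁ F A
  ⊆-c◁ A {x} x∈A y y◁x = x , y◁x , x∈A

  closed⇒fixpoint : (A : Subset X) → Closed A → IsFixpoint F A
  closed⇒fixpoint A closed = closed , ⊆-c◁ A

  □◁ : Subset X → Subset X
  □◁ P x = ∀ x' → x' ◁ x → P x'

  □◁-closed : (P : Subset X) → Closed (□◁ P)
  □◁-closed P x∈c x' x'◁x with x∈c x' x'◁x
  ... | z , x'◁z , z∈□◁P = z∈□◁P x' x'◁z

  □R-closed : (A : Subset X) → Closed A → Closed (□R F A)
  □R-closed A closed {x} x∈c y xRy = closed λ z z◁y →
    let x' , x'◁x , below-x' = frame-cond xRy z◁y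
        w , x'◁w , w∈□RA = x∈c x' x'◁x
        y'' , wRy'' , z◁y'' = below-x' w x'◁w
    in y'' , z◁y'' , w∈□RA y'' wRy''

  ◇Q-closed : (A : Subset X) → Closed (◇Q F A)
  ◇Q-closed A = □◁-closed λ x' → ∃ (λ y' → Q x' y' × ∃ λ y → y' ◁ y × A y)

  □R-⋂ : (I : Set) (A : I → Subset X) →
    □R F (meet F I A) ≐ meet F I (□R F ∘ A)
  □R-⋂ I A = (λ x∈□⋂ i y xRy → x∈□⋂ y xRy i) , (λ x∈⋂□ y xRy i → x∈⋂□ i y xRy)

  ◇Q-mono : {A B : Subset X} → A ⊆ B → ◇Q F A ⊆ ◇Q F B
  ◇Q-mono A⊆B x∈◇A x' x'◁x with x∈◇A x' x'◁x
  ... | y' , x'Qy' , y , y'◁y , y∈A = y' , x'Qy' , y , y'◁y , A⊆B y∈A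

proposition3p3 : (F : ModalFrame) →
    let open ModalFrame F in
    ((A : Subset X) → IsFixpoint F A → IsFixpoint F (□R F A))
    × ((A : Subset X) → IsFixpoint F A → IsFixpoint F (◇Q F A))
    × ((I : Set) (A : I → Subset X) → (∀ i → IsFixpoint F (A i)) →
         □R F (meet F I A) ≐ meet F I (λ i → □R F (A i)))
    × ((A B : Subset X) → IsFixpoint F A → IsFixpoint F B → A ⊆ B →
         ◇Q F A ⊆ ◇Q F B)
proposition3p3 F =
    (λ A (c◁A⊆A , _) → closed⇒fixpoint F (□R F A) (□R-closed F A c◁A⊆A))
  , (λ A _ → closed⇒fixpoint F (◇Q F A) (◇Q-closed F A))
  , (λ I A _ → □R-⋂ F I A)
  , (λ A B _ _ → ◇Q-mono F)
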